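{- Let $p$ be an odd prime and $(\alpha,\beta)\in(\mathbb{Z}/(p-1)\mathbb{Z})^2$ with $\alpha+\beta$ odd. Let $I_{(\alpha,\beta)}=\{\pm2\alpha,\pm2\beta,\pm\alpha\pm\beta\}\subseteq\mathbb{Z}/(p-1)\mathbb{Z}$. Then the conditions (1) $\#I_{(\alpha,\beta)}=8$, (2) $1\notin I_{(\alpha,\beta)}$, (3) $\mathcal{C}(\bar\chi^{p-\epsilon})=0$ for all $\epsilon\in I_{(\alpha,\beta)}$ are together equivalent to the conditions (a) $(\alpha,\beta)$ is not a solution $(x,y)$ of any of the equations $2x=\pm\epsilon$, $2y=\pm\epsilon$ for $\epsilon\in\bar{\mathcal{E}}$; (b) $(\alpha,\beta)$ is not a solution of any of the equations $y=\pm x\pm\epsilon$ for $\epsilon\in\bar{\mathcal{E}}$, where all equations are in $\mathbb{Z}/(p-1)\mathbb{Z}$.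
   Context: Parity is well defined on $\mathbb{Z}/(p-1)\mathbb{Z}$ since $p-1$ is even. $\bar\chi$ is the mod-$p$ cyclotomic character. Let $\mathcal{C}$ be the class group of $\mathbb{Q}(\mu_p)$ tensored with $\mathbb{F}_p$, with the natural action of $\operatorname{Gal}(\mathbb{Q}(\mu_p)/\mathbb{Q})$, and for $i\in\mathbb{Z}/(p-1)\mathbb{Z}$ let $\mathcal{C}(\bar\chi^i)=\{x\in\mathcal{C}:g\cdot x=\bar\chi^i(g)x\ \forall g\}$. Let $\mathcal{E}=\{\epsilon\in\mathbb{Z}/(p-1)\mathbb{Z}:\mathcal{C}(\bar\chi^\epsilon)\neq0\}$, $\mathcal{E}^*=\{p-\epsilon\in\mathbb{Z}/(p-1)\mathbb{Z}:\epsilon\in\mathcal{E}\}\setminus\{0,\tfrac{p-1}{2}\}$, and $\bar{\mathcal{E}}=\mathcal{E}^*\cup\{0,1,\tfrac{p-1}{2}\}$. -}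

module Defs where

open import Data.Nat as ℕ using (ℕ)
open import Data.Nat.DivMod using (_/_)
open import Data.Integer using (ℤ; +_; _+_; _-_; -_; _*_)
open import Data.Integer.Divisibility using (_∣_)
open import Data.Fin using (Fin)
open import Data.Vec using (Vec; _∷_; []; lookup)
open import Data.Product using (_×_; ∃)
open import Data.Sum using (_⊎_)
open import Data.Empty using (⊥)
open import Relation.Nullary using (¬_)
open import Relation.Binary.PropositionalEquality using (_≢_)

-- Elements of ℤ/(p-1)ℤ are represented by integers; equality in ℤ/(p-1)ℤ
-- is congruence modulo (p-1).
_≡_[mod_] : ℤ → ℤ → ℕ → Set
a ≡ b [mod m ] = (+ m) ∣ (a - b)

infix 4 _≡_[mod_]

-- odd integer (parity is well defined mod p-1 since p-1 is even)
OddZ : ℤ → Set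
OddZ a = ¬ ((+ 2) ∣ a)

Ilist : ℤ → ℤ → Vec ℤ 8
Ilist α β =
  (+ 2 * α) ∷ (- (+ 2 * α)) ∷ (+ 2 * β) ∷ (- (+ 2 * β)) ∷
  (α + β) ∷ (α - β) ∷ (- α + β) ∷ (- α - β) ∷ []

InI : ℕ → ℤ → ℤ → ℤ → Set
InI p α β ε = ∃ λ (i : Fin 8) → ε ≡ lookup (Ilist α β) i [mod (p ℕ.∸ 1) ]

Card8 : ℕ → ℤ → ℤ → Set
Card8 p α β = (i j : Fin 8) → i ≢ j →
  ¬ (lookup (Ilist α β) i ≡ lookup (Ilist α β) j [mod (p ℕ.∸ 1) ])

half : ℕ → ℤ
half p = + ((p ℕ.∸ 1) / 2)

-- NZ i stands for "C(χ̄^i) ≠ 0", so ε ∈ 𝓔 ⇔ NZ ε.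
-- 𝓔* = {p - ε : ε ∈ 𝓔} \ {0, (p-1)/2}
EStar : ℕ → (ℤ → Set) → ℤ → Set
EStar p NZ x =
  (∃ λ e → NZ e × x ≡ (+ p) - e [mod (p ℕ.∸ 1) ]) ×
  ¬ (x ≡ + 0 [mod (p ℕ.∸ 1) ]) × ¬ (x ≡ half p [mod (p ℕ.∸ 1) ])

EBar : ℕ → (ℤ → Set) → ℤ → Set
EBar p NZ x =
  EStar p NZ x ⊎ (x ≡ + 0 [mod (p ℕ.∸ 1) ]) ⊎ (x ≡ + 1 [mod (p ℕ.∸ 1) ])
  ⊎ (x ≡ half p [mod (p ℕ.∸ 1) ])

Cond123 : ℕ → (ℤ → Set) → ℤ → ℤ → Set
Cond123 p NZ α β =
  Card8 p α β × ¬ InI p α β (+ 1) ×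
  ((ε : ℤ) → InI p α β ε → ¬ NZ ((+ p) - ε))

CondA : ℕ → (ℤ → Set) → ℤ → ℤ → Set
CondA p NZ α β = (e : ℤ) → EBar p NZ e →
  ¬ ((+ 2 * α ≡ e [mod (p ℕ.∸ 1) ]) ⊎ (+ 2 * α ≡ - e [mod (p ℕ.∸ 1) ])
     ⊎ (+ 2 * β ≡ e [mod (p ℕ.∸ 1) ]) ⊎ (+ 2 * β ≡ - e [mod (p ℕ.∸ 1) ]))

CondB : ℕ → (ℤ → Set) → ℤ → ℤ → Set
CondB p NZ α β = (e : ℤ) → EBar p NZ e →
  ¬ ((β ≡ α + e [mod (p ℕ.∸ 1) ]) ⊎ (β ≡ α - e [mod (p ℕ.∸ 1) ])
     ⊎ (β ≡ - α + e [mod (p ℕ.∸ 1) ]) ⊎ (β ≡ - α - e [mod (p ℕ.∸ 1) ]))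

{-# OPTIONS --safe #-}
-- Both sides say that I_(α,β) is disjoint from Ē. The equations in (a) and (b) are exactly
-- the eight ways for ε to lie in I_(α,β). On the other side, (3) rules out I ∩ 𝓔*, (2) rules
-- out 1, and an entry x ≡ 0 or (p-1)/2 has 2x ≡ 0, so x ≡ -x is a repetition violating (1).
-- Conversely, writing the entries as linear forms in α and β, the difference of two of them is
-- either an entry, or twice an entry, or α + β plus an even form; so a repetition forces an
-- entry to be 0 or (p-1)/2, or α + β to be even modulo the even number p - 1.
module Submission where

open import Defs
open import Data.Nat using (ℕ; _∸_)
open import Data.Nat.Primality using (Prime)
open import Data.Integer using (ℤ)
open import Data.Product using (_×_)
open import Function.Bundles using (_⇔_)
open import Relation.Binary.PropositionalEquality using (_≢_)

open import Data.Nat as ℕ using (suc)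
open import Data.Nat.DivMod using (_/_; m*[n/m]≡n)
import Data.Nat.Divisibility as ℕ
open import Data.Nat.Primality using (¬prime[0]; prime⇒irreducible)
open import Data.Integer using (+_; -_; _-_; _*_; _+_)
import Data.Integer.Properties as ℤ
open import Data.Integer.DivMod using (_/ℕ_; _%ℕ_; n%ℕd<d; a≡a%ℕn+[a/ℕn]*n)
open import Data.Integer.Divisibility using (_∣_)
open import Data.Integer.Divisibility.Signed
  renaming (_∣_ to _∣ₛ_)
  using (divides; ∣ᵤ⇒∣; ∣⇒∣ᵤ; _∣?_; ∣m⇒∣-m; ∣m∣n⇒∣m+n; ∣m+n∣n⇒∣m; ∣n⇒∣m*n; ∣m⇒∣m*n; ∣-refl;
         ∣-trans; *-cancelˡ-∣)
open import Data.Integer.Tactic.RingSolver using (solve-∀)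
open import Data.Fin using (Fin; zero; suc)
open import Data.Fin.Properties using (_≟_; all?; any?)
open import Data.Vec using (lookup)
open import Data.Product using (_,_; ∃)
open import Data.Product.Properties using (≡-dec)
open import Data.Sum using (_⊎_; inj₁; inj₂)
open import Data.Empty using (⊥-elim)
open import Relation.Nullary using (¬_; Dec; ¬?)
open import Relation.Nullary.Decidable using (_×-dec_; _⊎-dec_; _→-dec_; from-yes)
open import Relation.Binary.PropositionalEquality
  using (_≡_; refl; sym; trans; cong; cong₂; subst; subst₂)
open import Function.Base using (_∋_; _∘_)
open import Function.Bundles using (mk⇔; Equivalence)
import Function.Properties.Equivalence as ⇔

-- Endpoints are explicit throughout: a ≡ b [mod m ] unfolds to a statement about ∣ a - b ∣,
-- from which Agda cannot recover a and b.
module _ {m : ℕ} where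

  ≡-mod⇒∣ : ∀ a b → a ≡ b [mod m ] → + m ∣ₛ (a - b)
  ≡-mod⇒∣ a b = ∣ᵤ⇒∣

  ∣⇒≡-mod : ∀ a b → + m ∣ₛ (a - b) → a ≡ b [mod m ]
  ∣⇒≡-mod a b = ∣⇒∣ᵤ

  ≡-mod-by-gap : ∀ {x y} → x ≡ y → + m ∣ x → + m ∣ y
  ≡-mod-by-gap = subst (+ m ∣_)

  ≡-mod-refl : ∀ a → a ≡ a [mod m ]
  ≡-mod-refl a = subst (+ m ∣_) (sym (ℤ.+-inverseʳ a)) (m ℕ.∣0)

  ≡-mod-reflexive : ∀ {a b} → a ≡ b → a ≡ b [mod m ]
  ≡-mod-reflexive {a} refl = ≡-mod-refl a

  ≡-mod-sym : ∀ a b → a ≡ b [mod m ] → b ≡ a [mod m ]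
  ≡-mod-sym a b a≡b =
    ∣⇒≡-mod b a (subst (+ m ∣ₛ_) (negated-gap a b) (∣m⇒∣-m (≡-mod⇒∣ a b a≡b)))
    where
    negated-gap : ∀ a b → - (a - b) ≡ b - a
    negated-gap = solve-∀

  ≡-mod-trans : ∀ a b c → a ≡ b [mod m ] → b ≡ c [mod m ] → a ≡ c [mod m ]
  ≡-mod-trans a b c a≡b b≡c =
    ∣⇒≡-mod a c
      (subst (+ m ∣ₛ_) (telescope a b c) (∣m∣n⇒∣m+n (≡-mod⇒∣ a b a≡b) (≡-mod⇒∣ b c b≡c)))
    where
    telescope : ∀ a b c → (a - b) + (b - c) ≡ a - c
    telescope = solve-∀

module _ {m h : ℕ} (m≡2h : m ≡ 2 ℕ.* h) where

  private
    m≡2*h : + m ≡ + 2 * + h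
    m≡2*h = trans (cong +_ m≡2h) (ℤ.pos-* 2 h)

  multiple-of-half : ∀ {x} → + h ∣ₛ x → + m ∣ₛ x ⊎ + m ∣ₛ (x - + h)
  multiple-of-half {x} (divides q x≡qh) with q %ℕ 2 | n%ℕd<d q 2 | a≡a%ℕn+[a/ℕn]*n q 2
  ... | 0 | _ | q≡2t = inj₁ (divides (q /ℕ 2) (begin
    x                              ≡⟨ x≡qh ⟩
    q * + h                        ≡⟨ cong (_* + h) q≡2t ⟩
    (+ 0 + (q /ℕ 2) * + 2) * + h   ≡⟨ even-multiple (q /ℕ 2) (+ h) ⟩
    q /ℕ 2 * (+ 2 * + h)           ≡⟨ cong (q /ℕ 2 *_) (sym m≡2*h) ⟩
    q /ℕ 2 * + m                   ∎))
    where
    open Relation.Binary.PropositionalEquality.≡-Reasoning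
    even-multiple : ∀ t y → (+ 0 + t * + 2) * y ≡ t * (+ 2 * y)
    even-multiple = solve-∀
  ... | 1 | _ | q≡2t+1 = inj₂ (divides (q /ℕ 2) (begin
    x - + h                             ≡⟨ cong (_- + h) x≡qh ⟩
    q * + h - + h                       ≡⟨ cong (λ q → q * + h - + h) q≡2t+1 ⟩
    (+ 1 + (q /ℕ 2) * + 2) * + h - + h  ≡⟨ odd-multiple (q /ℕ 2) (+ h) ⟩
    q /ℕ 2 * (+ 2 * + h)                ≡⟨ cong (q /ℕ 2 *_) (sym m≡2*h) ⟩
    q /ℕ 2 * + m                        ∎))
    where
    open Relation.Binary.PropositionalEquality.≡-Reasoning
    odd-multiple : ∀ t y → (+ 1 + t * + 2) * y - y ≡ t * (+ 2 * y)
    odd-multiple = solve-∀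
  ... | suc (suc _) | ℕ.s≤s (ℕ.s≤s ()) | _

  halving : ∀ x → (+ 2 * x ≡ + 0 [mod m ]) ⇔ (x ≡ + 0 [mod m ] ⊎ x ≡ + h [mod m ])
  halving x = mk⇔ halve double
    where
    h∣x : + 2 * x ≡ + 0 [mod m ] → + h ∣ₛ x
    h∣x 2x≡0 = *-cancelˡ-∣ (+ 2)
      (subst₂ _∣ₛ_ m≡2*h (ℤ.+-identityʳ (+ 2 * x)) (≡-mod⇒∣ (+ 2 * x) (+ 0) 2x≡0))

    halve : + 2 * x ≡ + 0 [mod m ] → x ≡ + 0 [mod m ] ⊎ x ≡ + h [mod m ]
    halve 2x≡0 with multiple-of-half (h∣x 2x≡0)
    ... | inj₁ m∣x = inj₁ (∣⇒≡-mod x (+ 0) (subst (+ m ∣ₛ_) (sym (ℤ.+-identityʳ x)) m∣x))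
    ... | inj₂ m∣x-h = inj₂ (∣⇒≡-mod x (+ h) m∣x-h)

    double : x ≡ + 0 [mod m ] ⊎ x ≡ + h [mod m ] → + 2 * x ≡ + 0 [mod m ]
    double (inj₁ x≡0) = ∣⇒≡-mod (+ 2 * x) (+ 0)
      (subst (+ m ∣ₛ_) (scale-gap x) (∣n⇒∣m*n (+ 2) (≡-mod⇒∣ x (+ 0) x≡0)))
      where
      scale-gap : ∀ x → + 2 * (x - + 0) ≡ + 2 * x - + 0
      scale-gap = solve-∀
    double (inj₂ x≡h) = ∣⇒≡-mod (+ 2 * x) (+ 0)
      (subst (+ m ∣ₛ_) (trans (cong (_+_ (+ 2 * (x - + h))) m≡2*h) (shift-by-period x (+ h)))
        (∣m∣n⇒∣m+n (∣n⇒∣m*n (+ 2) (≡-mod⇒∣ x (+ h) x≡h)) ∣-refl))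
      where
      shift-by-period : ∀ x y → + 2 * (x - y) + + 2 * y ≡ + 2 * x - + 0
      shift-by-period = solve-∀

2∣n⊎2∣1+n : ∀ n → 2 ℕ.∣ n ⊎ 2 ℕ.∣ suc n
2∣n⊎2∣1+n 0 = inj₁ (2 ℕ.∣0)
2∣n⊎2∣1+n (suc n) with 2∣n⊎2∣1+n n
... | inj₁ 2∣n = inj₂ (ℕ.∣m∣n⇒∣m+n (ℕ.∣-refl {2}) 2∣n)
... | inj₂ 2∣1+n = inj₁ 2∣1+n

odd-prime⇒2∣p∸1 : ∀ {p} → Prime p → p ≢ 2 → 2 ℕ.∣ p ∸ 1
odd-prime⇒2∣p∸1 {0} p-prime _ = ⊥-elim (¬prime[0] p-prime)
odd-prime⇒2∣p∸1 {suc n} p-prime p≢2 with 2∣n⊎2∣1+n n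
... | inj₁ 2∣n = 2∣n
... | inj₂ 2∣p with prime⇒irreducible p-prime 2∣p
...   | inj₁ ()
...   | inj₂ 2≡p = ⊥-elim (p≢2 (sym 2≡p))

Form : Set
Form = ℤ × ℤ

⟦_⟧ : Form → ℤ → ℤ → ℤ
⟦ a , b ⟧ α β = a * α + b * β

infixl 6 _⊝_

_⊝_ : Form → Form → Form
(a , b) ⊝ (c , d) = a - c , b - d

twice : Form → Form
twice (a , b) = + 2 * a , + 2 * b

⟦⟧-⊝ : ∀ u v α β → ⟦ u ⊝ v ⟧ α β ≡ ⟦ u ⟧ α β - ⟦ v ⟧ α β
⟦⟧-⊝ (a , b) (c , d) = difference a b c d
  where
  difference : ∀ a b c d α β → (a - c) * α + (b - d) * β ≡ (a * α + b * β) - (c * α + d * β)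
  difference = solve-∀

⟦⟧-twice : ∀ u α β → ⟦ twice u ⟧ α β ≡ + 2 * ⟦ u ⟧ α β
⟦⟧-twice (a , b) = doubling a b
  where
  doubling : ∀ a b α β → (+ 2 * a) * α + (+ 2 * b) * β ≡ + 2 * (a * α + b * β)
  doubling = solve-∀

BothOdd : Form → Set
BothOdd (a , b) = + 2 ∣ₛ a - + 1 × + 2 ∣ₛ b - + 1

both-odd? : ∀ u → Dec (BothOdd u)
both-odd? (a , b) = (+ 2 ∣? (a - + 1)) ×-dec (+ 2 ∣? (b - + 1))

both-odd⇒parity : ∀ u α β → BothOdd u → + 2 ∣ₛ ⟦ u ⟧ α β → + 2 ∣ₛ α + β
both-odd⇒parity (a , b) α β (2∣a-1 , 2∣b-1) 2∣form =
  ∣m+n∣n⇒∣m (subst (+ 2 ∣ₛ_) (split a b α β) 2∣form)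
    (∣m∣n⇒∣m+n (∣m⇒∣m*n α 2∣a-1) (∣m⇒∣m*n β 2∣b-1))
  where
  split : ∀ a b α β → a * α + b * β ≡ (α + β) + ((a - + 1) * α + (b - + 1) * β)
  split = solve-∀

pattern 2α = zero
pattern -2α = suc zero
pattern 2β = suc (suc zero)
pattern -2β = suc (suc (suc zero))
pattern α+β = suc (suc (suc (suc zero)))
pattern α-β = suc (suc (suc (suc (suc zero))))
pattern -α+β = suc (suc (suc (suc (suc (suc zero)))))
pattern -α-β = suc (suc (suc (suc (suc (suc (suc zero))))))

coeff : Fin 8 → Form
coeff 2α = + 2 , + 0
coeff -2α = - + 2 , + 0
coeff 2β = + 0 , + 2
coeff -2β = + 0 , - + 2
coeff α+β = + 1 , + 1
coeff α-β = + 1 , - + 1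
coeff -α+β = - + 1 , + 1
coeff -α-β = - + 1 , - + 1

-- solve-∀ does not unfold lookup, so each entry's identity is spelled out.
I-linear : ∀ α β k → lookup (Ilist α β) k ≡ ⟦ coeff k ⟧ α β
I-linear α β 2α = ((∀ α β → + 2 * α ≡ + 2 * α + + 0 * β) ∋ solve-∀) α β
I-linear α β -2α = ((∀ α β → - (+ 2 * α) ≡ - + 2 * α + + 0 * β) ∋ solve-∀) α β
I-linear α β 2β = ((∀ α β → + 2 * β ≡ + 0 * α + + 2 * β) ∋ solve-∀) α β
I-linear α β -2β = ((∀ α β → - (+ 2 * β) ≡ + 0 * α + - + 2 * β) ∋ solve-∀) α β
I-linear α β α+β = ((∀ α β → α + β ≡ + 1 * α + + 1 * β) ∋ solve-∀) α β
I-linear α β α-β = ((∀ α β → α - β ≡ + 1 * α + - + 1 * β) ∋ solve-∀) α β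
I-linear α β -α+β = ((∀ α β → - α + β ≡ - + 1 * α + + 1 * β) ∋ solve-∀) α β
I-linear α β -α-β = ((∀ α β → - α - β ≡ - + 1 * α + - + 1 * β) ∋ solve-∀) α β

infix 4 _≟ᶠ_

_≟ᶠ_ : (u v : Form) → Dec (u ≡ v)
_≟ᶠ_ = ≡-dec ℤ._≟_ ℤ._≟_

CollisionWitness : Form → Set
CollisionWitness u = (∃ λ k → u ≡ coeff k) ⊎ (∃ λ k → u ≡ twice (coeff k)) ⊎ BothOdd u

collision-witness? : ∀ u → Dec (CollisionWitness u)
collision-witness? u =
  any? (λ k → u ≟ᶠ coeff k) ⊎-dec any? (λ k → u ≟ᶠ twice (coeff k)) ⊎-dec both-odd? u

coeff-collision : ∀ i j → i ≢ j → CollisionWitness (coeff i ⊝ coeff j)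
coeff-collision =
  from-yes (all? λ i → all? λ j → ¬? (i ≟ j) →-dec collision-witness? (coeff i ⊝ coeff j))

coeff-negation : ∀ k → ∃ λ j → k ≢ j × coeff k ⊝ coeff j ≡ twice (coeff k)
coeff-negation =
  from-yes (all? λ k → any? λ j → ¬? (k ≟ j) ×-dec (coeff k ⊝ coeff j ≟ᶠ twice (coeff k)))

module AvoidanceCriterion (p : ℕ) (p∸1≡2h : p ∸ 1 ≡ 2 ℕ.* ((p ∸ 1) / 2))
  (NZ : ℤ → Set) (NZ-resp : (a b : ℤ) → a ≡ b [mod (p ∸ 1) ] → NZ a → NZ b)
  (α β : ℤ) (α+β-odd : OddZ (α + β)) where

  infix 4 _≈_
  _≈_ : ℤ → ℤ → Set
  a ≈ b = a ≡ b [mod (p ∸ 1) ]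

  I : Fin 8 → ℤ
  I = lookup (Ilist α β)

  Ē : ℤ → Set
  Ē = EBar p NZ

  Ē-resp : ∀ a b → a ≈ b → Ē a → Ē b
  Ē-resp a b a≈b (inj₁ ((e , nz , a≈p-e) , a≉0 , a≉h)) =
    inj₁ ((e , nz , shift (+ p - e) a≈p-e) , a≉0 ∘ unshift (+ 0) , a≉h ∘ unshift (half p))
    where
    shift : ∀ t → a ≈ t → b ≈ t
    shift t = ≡-mod-trans b a t (≡-mod-sym a b a≈b)
    unshift : ∀ t → b ≈ t → a ≈ t
    unshift t = ≡-mod-trans a b t a≈b
  Ē-resp a b a≈b (inj₂ (inj₁ a≈0)) = inj₂ (inj₁ (≡-mod-trans b a (+ 0) (≡-mod-sym a b a≈b) a≈0))
  Ē-resp a b a≈b (inj₂ (inj₂ (inj₁ a≈1))) =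
    inj₂ (inj₂ (inj₁ (≡-mod-trans b a (+ 1) (≡-mod-sym a b a≈b) a≈1)))
  Ē-resp a b a≈b (inj₂ (inj₂ (inj₂ a≈h))) =
    inj₂ (inj₂ (inj₂ (≡-mod-trans b a (half p) (≡-mod-sym a b a≈b) a≈h)))

  halving-mod-p∸1 : ∀ x → (+ 2 * x ≈ + 0) ⇔ (x ≈ + 0 ⊎ x ≈ half p)
  halving-mod-p∸1 = halving {h = (p ∸ 1) / 2} p∸1≡2h

  2-torsion-in-Ē : ∀ x → + 2 * x ≈ + 0 → Ē x
  2-torsion-in-Ē x 2x≈0 with Equivalence.to (halving-mod-p∸1 x) 2x≈0
  ... | inj₁ x≈0 = inj₂ (inj₁ x≈0)
  ... | inj₂ x≈h = inj₂ (inj₂ (inj₂ x≈h))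

  Avoids : Set
  Avoids = ∀ k → ¬ Ē (I k)

  avoids-I : Avoids → ∀ e → InI p α β e → ¬ Ē e
  avoids-I avoids e (k , e≈Ik) e∈Ē = avoids k (Ē-resp e (I k) e≈Ik e∈Ē)

  I-gap : ∀ i j → I i - I j ≡ ⟦ coeff i ⊝ coeff j ⟧ α β
  I-gap i j = begin
    I i - I j                                 ≡⟨ cong₂ _-_ (I-linear α β i) (I-linear α β j) ⟩
    ⟦ coeff i ⟧ α β - ⟦ coeff j ⟧ α β         ≡⟨ ⟦⟧-⊝ (coeff i) (coeff j) α β ⟨
    ⟦ coeff i ⊝ coeff j ⟧ α β                 ∎
    where open Relation.Binary.PropositionalEquality.≡-Reasoning

  entry-gap : ∀ i j k → coeff i ⊝ coeff j ≡ coeff k → I i - I j ≡ I k - + 0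
  entry-gap i j k gap = begin
    I i - I j                   ≡⟨ I-gap i j ⟩
    ⟦ coeff i ⊝ coeff j ⟧ α β   ≡⟨ cong (λ u → ⟦ u ⟧ α β) gap ⟩
    ⟦ coeff k ⟧ α β             ≡⟨ I-linear α β k ⟨
    I k                         ≡⟨ ℤ.+-identityʳ (I k) ⟨
    I k - + 0                   ∎
    where open Relation.Binary.PropositionalEquality.≡-Reasoning

  twice-gap : ∀ i j k → coeff i ⊝ coeff j ≡ twice (coeff k) → I i - I j ≡ + 2 * I k - + 0
  twice-gap i j k gap = begin
    I i - I j                   ≡⟨ I-gap i j ⟩
    ⟦ coeff i ⊝ coeff j ⟧ α β   ≡⟨ cong (λ u → ⟦ u ⟧ α β) gap ⟩
    ⟦ twice (coeff k) ⟧ α β     ≡⟨ ⟦⟧-twice (coeff k) α β ⟩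
    + 2 * ⟦ coeff k ⟧ α β       ≡⟨ cong (+ 2 *_) (I-linear α β k) ⟨
    + 2 * I k                   ≡⟨ ℤ.+-identityʳ (+ 2 * I k) ⟨
    + 2 * I k - + 0             ∎
    where open Relation.Binary.PropositionalEquality.≡-Reasoning

  2∣p∸1 : + 2 ∣ₛ + (p ∸ 1)
  2∣p∸1 = divides (+ h)
    (trans (cong +_ p∸1≡2h) (trans (ℤ.pos-* 2 h) (ℤ.*-comm (+ 2) (+ h))))
    where h = (p ∸ 1) / 2

  no-odd-collision : ∀ i j → BothOdd (coeff i ⊝ coeff j) → ¬ I i ≈ I j
  no-odd-collision i j odd Ii≈Ij = α+β-odd (∣⇒∣ᵤ (both-odd⇒parity (coeff i ⊝ coeff j) α β odd
    (∣-trans 2∣p∸1 (subst (+ (p ∸ 1) ∣ₛ_) (I-gap i j) (≡-mod⇒∣ (I i) (I j) Ii≈Ij)))))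

  SolvesA SolvesB : ℤ → Set
  SolvesA e = (+ 2 * α ≈ e) ⊎ (+ 2 * α ≈ - e) ⊎ (+ 2 * β ≈ e) ⊎ (+ 2 * β ≈ - e)
  SolvesB e = (β ≈ α + e) ⊎ (β ≈ α - e) ⊎ (β ≈ - α + e) ⊎ (β ≈ - α - e)

  private
    negate-gap : ∀ x e → x - - e ≡ e - - x
    negate-gap = solve-∀
    gap-α+e : ∀ α β e → β - (α + e) ≡ (- α + β) - e
    gap-α+e = solve-∀
    gap-α-e : ∀ α β e → β - (α - e) ≡ e - (α - β)
    gap-α-e = solve-∀
    gap--α+e : ∀ α β e → β - (- α + e) ≡ (α + β) - e
    gap--α+e = solve-∀
    gap--α-e : ∀ α β e → β - (- α - e) ≡ e - (- α - β)
    gap--α-e = solve-∀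

  solution⇒I : ∀ e → SolvesA e ⊎ SolvesB e → InI p α β e
  solution⇒I e (inj₁ (inj₁ 2α≈e)) = 2α , ≡-mod-sym (+ 2 * α) e 2α≈e
  solution⇒I e (inj₁ (inj₂ (inj₁ 2α≈-e))) =
    -2α , ≡-mod-by-gap (negate-gap (+ 2 * α) e) 2α≈-e
  solution⇒I e (inj₁ (inj₂ (inj₂ (inj₁ 2β≈e)))) = 2β , ≡-mod-sym (+ 2 * β) e 2β≈e
  solution⇒I e (inj₁ (inj₂ (inj₂ (inj₂ 2β≈-e)))) =
    -2β , ≡-mod-by-gap (negate-gap (+ 2 * β) e) 2β≈-e
  solution⇒I e (inj₂ (inj₁ β≈α+e)) =
    -α+β , ≡-mod-sym (- α + β) e (≡-mod-by-gap (gap-α+e α β e) β≈α+e)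
  solution⇒I e (inj₂ (inj₂ (inj₁ β≈α-e))) = α-β , ≡-mod-by-gap (gap-α-e α β e) β≈α-e
  solution⇒I e (inj₂ (inj₂ (inj₂ (inj₁ β≈-α+e)))) =
    α+β , ≡-mod-sym (α + β) e (≡-mod-by-gap (gap--α+e α β e) β≈-α+e)
  solution⇒I e (inj₂ (inj₂ (inj₂ (inj₂ β≈-α-e)))) =
    -α-β , ≡-mod-by-gap (gap--α-e α β e) β≈-α-e

  I-solves : ∀ k → SolvesA (I k) ⊎ SolvesB (I k)
  I-solves 2α = inj₁ (inj₁ (≡-mod-refl (+ 2 * α)))
  I-solves -2α = inj₁ (inj₂ (inj₁ (≡-mod-reflexive (sym (ℤ.neg-involutive (+ 2 * α))))))
  I-solves 2β = inj₁ (inj₂ (inj₂ (inj₁ (≡-mod-refl (+ 2 * β)))))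
  I-solves -2β = inj₁ (inj₂ (inj₂ (inj₂ (≡-mod-reflexive (sym (ℤ.neg-involutive (+ 2 * β)))))))
  I-solves α+β = inj₂ (inj₂ (inj₂ (inj₁ (≡-mod-reflexive (cancel--α+ α β)))))
    where
    cancel--α+ : ∀ α β → β ≡ - α + (α + β)
    cancel--α+ = solve-∀
  I-solves α-β = inj₂ (inj₂ (inj₁ (≡-mod-reflexive (cancel-α- α β))))
    where
    cancel-α- : ∀ α β → β ≡ α - (α - β)
    cancel-α- = solve-∀
  I-solves -α+β = inj₂ (inj₁ (≡-mod-reflexive (cancel-α+ α β)))
    where
    cancel-α+ : ∀ α β → β ≡ α + (- α + β)
    cancel-α+ = solve-∀
  I-solves -α-β = inj₂ (inj₂ (inj₂ (inj₂ (≡-mod-reflexive (cancel--α- α β)))))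
    where
    cancel--α- : ∀ α β → β ≡ - α - (- α - β)
    cancel--α- = solve-∀

  AB⇔avoids : (CondA p NZ α β × CondB p NZ α β) ⇔ Avoids
  AB⇔avoids = mk⇔ AB⇒avoids avoids⇒AB
    where
    AB⇒avoids : CondA p NZ α β × CondB p NZ α β → Avoids
    AB⇒avoids (A , B) k Ik∈Ē with I-solves k
    ... | inj₁ solvesA = A (I k) Ik∈Ē solvesA
    ... | inj₂ solvesB = B (I k) Ik∈Ē solvesB

    avoids⇒AB : Avoids → CondA p NZ α β × CondB p NZ α β
    avoids⇒AB avoids =
        (λ e e∈Ē solvesA → avoids-I avoids e (solution⇒I e (inj₁ solvesA)) e∈Ē)
      , (λ e e∈Ē solvesB → avoids-I avoids e (solution⇒I e (inj₂ solvesB)) e∈Ē)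

  distinct⇒no-2-torsion : Card8 p α β → ∀ k → ¬ (+ 2 * I k ≈ + 0)
  distinct⇒no-2-torsion distinct k 2Ik≈0 with coeff-negation k
  ... | j , k≢j , gap = distinct k j k≢j (≡-mod-by-gap (sym (twice-gap k j k gap)) 2Ik≈0)

  cond123⇒avoids : Cond123 p NZ α β → Avoids
  cond123⇒avoids (_ , _ , ε∈I⇒Z) k (inj₁ ((e , nz , Ik≈p-e) , _)) =
    ε∈I⇒Z (I k) (k , ≡-mod-refl (I k))
      (NZ-resp e (+ p - I k) (≡-mod-by-gap (swap (I k) e (+ p)) Ik≈p-e) nz)
    where
    swap : ∀ x e P → x - (P - e) ≡ e - (P - x)
    swap = solve-∀
  cond123⇒avoids (distinct , _ , _) k (inj₂ (inj₁ Ik≈0)) =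
    distinct⇒no-2-torsion distinct k (Equivalence.from (halving-mod-p∸1 (I k)) (inj₁ Ik≈0))
  cond123⇒avoids (_ , 1∉I , _) k (inj₂ (inj₂ (inj₁ Ik≈1))) = 1∉I (k , ≡-mod-sym (I k) (+ 1) Ik≈1)
  cond123⇒avoids (distinct , _ , _) k (inj₂ (inj₂ (inj₂ Ik≈h))) =
    distinct⇒no-2-torsion distinct k (Equivalence.from (halving-mod-p∸1 (I k)) (inj₂ Ik≈h))

  avoids⇒cond123 : Avoids → Cond123 p NZ α β
  avoids⇒cond123 avoids = distinct , 1∉I , ε∈I⇒Z
    where
    distinct : Card8 p α β
    distinct i j i≢j Ii≈Ij with coeff-collision i j i≢j
    ... | inj₁ (k , gap) = avoids k (inj₂ (inj₁ (≡-mod-by-gap (entry-gap i j k gap) Ii≈Ij)))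
    ... | inj₂ (inj₁ (k , gap)) =
      avoids k (2-torsion-in-Ē (I k) (≡-mod-by-gap (twice-gap i j k gap) Ii≈Ij))
    ... | inj₂ (inj₂ odd) = no-odd-collision i j odd Ii≈Ij

    1∉I : ¬ InI p α β (+ 1)
    1∉I 1∈I = avoids-I avoids (+ 1) 1∈I (inj₂ (inj₂ (inj₁ (≡-mod-refl (+ 1)))))

    ε∈I⇒Z : ∀ ε → InI p α β ε → ¬ NZ (+ p - ε)
    -- ε ∉ Ē already gives ε ≢ 0 and ε ≢ (p-1)/2, so NZ (p - ε) would put ε into 𝓔*.
    ε∈I⇒Z ε ε∈I nz =
      ε∉Ē (inj₁ ((+ p - ε , nz , ≡-mod-reflexive (double-negation ε (+ p)))
                , ε∉Ē ∘ inj₂ ∘ inj₁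
                , ε∉Ē ∘ inj₂ ∘ inj₂ ∘ inj₂))
      where
      ε∉Ē : ¬ Ē ε
      ε∉Ē = avoids-I avoids ε ε∈I
      double-negation : ∀ x P → x ≡ P - (P - x)
      double-negation = solve-∀

  cond123⇔avoids : Cond123 p NZ α β ⇔ Avoids
  cond123⇔avoids = mk⇔ cond123⇒avoids avoids⇒cond123

corollary5p5 : (p : ℕ) → Prime p → p ≢ 2 →
    (NZ : ℤ → Set) →
    ((a b : ℤ) → a ≡ b [mod (p ∸ 1) ] → NZ a → NZ b) →
    (α β : ℤ) → OddZ (α Data.Integer.+ β) →
    Cond123 p NZ α β ⇔ (CondA p NZ α β × CondB p NZ α β)
corollary5p5 p p-prime p≢2 NZ NZ-resp α β α+β-odd =
  ⇔.trans cond123⇔avoids (⇔.sym AB⇔avoids)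
  where
  open AvoidanceCriterion p (sym (m*[n/m]≡n (odd-prime⇒2∣p∸1 p-prime p≢2))) NZ NZ-resp α β α+β-odd
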